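{- Let $\mathcal{U}$ be a Ramsey ultrafilter, let $\dot C$ be an $\mathbb{M}_{\mathcal{U}}$-name for an infinite subset of $\omega$, and let $\langle s,x_1\rangle$ be an $\mathbb{M}_{\mathcal{U}}$-condition such that for every finite $t\subseteq x_1$ there is a finite set $C_t\subseteq\omega$ with $\langle s\cup t,\ x_1\setminus(\max t+1)\rangle\Vdash_{\mathbb{M}_{\mathcal{U}}}\dot C\cap(\max t+1)=C_t$. Then there exists $x_2\in\mathcal{U}$ with $x_2\subseteq x_1$ such that for every finite $t\subseteq x_2$, every $m\in x_2$ with $m\ge\max t$, and all $n,n'\in x_2$ with $n,n'>m$, we have \[C_{t\cup\{n\}}\cap(m+1)=C_{t\cup\{n'\}}\cap(m+1).\]
   Context: Ultrafilters are non-principal on $\omega$. An ultrafilter $\mathcal{U}$ is Ramsey iff the Maiden has no winning strategy in the game where the Maiden plays $y_0\in\mathcal{U}$, Death plays $n_0\in y_0$, and at stage $k+1$ the Maiden plays $y_{k+1}\in\mathcal{U}$, $y_{k+1}\subseteq y_k$, Death plays $n_{k+1}\in y_{k+1}$, $n_{k+1}>n_k$; Death wins iff $\{n_i:i\in\omega\}\in\mathcal{U}$. $\mathbb{M}_{\mathcal{U}}$ has conditions $\langle s,x\rangle$ with $s\subseteq\omega$ finite, $x\in\mathcal{U}$, $\max s<\min x$, ordered by $\langle s,x\rangle\le\langle t,y\rangle$ iff $s\subseteq t$, $y\subseteq x$, $t\setminus s\subseteq x$ (larger is stronger). Note that each $C_t$ is uniquely determined, since the stated condition decides $\dot C\cap(\max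 t+1)$. Natural numbers are von Neumann ordinals, $n+1=\{0,\dots,n\}$, and $\max\emptyset=0$. -}

module Defs where

open import Level using (0ℓ)
open import Data.Nat using (ℕ; zero; suc; _<_; _≤_; _⊔_; _<ᵇ_)
open import Data.Bool using (Bool; true; false; _∧_; not)
open import Data.List using (List; []; _∷_; _++_; foldr; [_]; map; upTo)
open import Data.List.Membership.Propositional using (_∈_)
open import Data.Product using (Σ; _×_; _,_; ∃; ∃-syntax)
open import Data.Sum using (_⊎_)
open import Relation.Nullary using (¬_)
open import Relation.Binary.PropositionalEquality using (_≡_)

Subset : Set
Subset = ℕ → Bool

_∈ˢ_ : ℕ → Subset → Set
k ∈ˢ x = x k ≡ true

_⊆ˢ_ : Subset → Subset → Set
x ⊆ˢ y = ∀ k → k ∈ˢ x → k ∈ˢ y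

_∩ˢ_ : Subset → Subset → Subset
(x ∩ˢ y) k = x k ∧ y k

∁ : Subset → Subset
∁ x k = not (x k)

∅ˢ : Subset
∅ˢ _ = false

Infiniteˢ : Subset → Set
Infiniteˢ x = ∀ n → ∃[ k ] (n < k × k ∈ˢ x)

-- finite subsets of ω are lists (order / repetitions irrelevant)
FinSet : Set
FinSet = List ℕ

_⊆ᶠ_ : FinSet → FinSet → Set
s ⊆ᶠ t = ∀ {k} → k ∈ s → k ∈ t

_⊆ᶠˢ_ : FinSet → Subset → Set
t ⊆ᶠˢ x = ∀ {k} → k ∈ t → k ∈ˢ x

-- max of a finite set, with max ∅ = 0
maxᶠ : FinSet → ℕ
maxᶠ = foldr _⊔_ 0

-- x ∖ (m+1) = { k ∈ x : m < k }
_∖↑_ : Subset → ℕ → Subset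
(x ∖↑ m) k = x k ∧ (m <ᵇ k)

record IsNPUltrafilter (U : Subset → Set) : Set where
  field
    upward       : ∀ {x y} → U x → x ⊆ˢ y → U y
    inter        : ∀ {x y} → U x → U y → U (x ∩ˢ y)
    proper       : ¬ U ∅ˢ
    ultra        : ∀ x → U x ⊎ U (∁ x)
    nonPrincipal : ∀ {x} → U x → Infiniteˢ x

-- A Maiden strategy: given Death's previous moves (oldest first),
-- the Maiden's next move.
Strategy : Set
Strategy = List ℕ → Subset

LegalStrategy : (Subset → Set) → Strategy → Set
LegalStrategy U σ = (∀ h → U (σ h)) × (∀ h n → σ (h ++ [ n ]) ⊆ˢ σ h)

prefix : (ℕ → ℕ) → ℕ → List ℕ
prefix d i = map d (upTo i)

ConsistentPlay : Strategy → (ℕ → ℕ) → Set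
ConsistentPlay σ d = (∀ i → d i ∈ˢ σ (prefix d i)) × (∀ i → d i < d (suc i))

-- Death wins iff { d i : i ∈ ω } ∈ U
DeathWins : (Subset → Set) → (ℕ → ℕ) → Set
DeathWins U d =
  ∃[ x ] (U x × (∀ k → (k ∈ˢ x → ∃[ i ] (d i ≡ k)) × (∃[ i ] (d i ≡ k) → k ∈ˢ x)))

WinningForMaiden : (Subset → Set) → Strategy → Set
WinningForMaiden U σ = ∀ d → ConsistentPlay σ d → ¬ DeathWins U d

IsRamsey : (Subset → Set) → Set
IsRamsey U = IsNPUltrafilter U × (∀ σ → LegalStrategy U σ → ¬ WinningForMaiden U σ)

Pair : Set
Pair = FinSet × Subset

IsCond : (Subset → Set) → Pair → Set
IsCond U (s , x) = U x × (∀ {i} → i ∈ s → ∀ j → j ∈ˢ x → i < j)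

-- ⟨s,x⟩ ≤ᴹ ⟨t,y⟩ : ⟨t,y⟩ is stronger
_≤ᴹ_ : Pair → Pair → Set
(s , x) ≤ᴹ (t , y) = (s ⊆ᶠ t) × (y ⊆ˢ x) × (∀ {k} → k ∈ t → ¬ (k ∈ s) → k ∈ˢ x)

-- A (nice) name for a subset of ω: the set of pairs ⟨ǩ , r⟩
Name : Set₁
Name = ℕ → Pair → Set

Forces∈ : (Subset → Set) → Name → Pair → ℕ → Set
Forces∈ U Ċ p k =
  ∀ q → IsCond U q → p ≤ᴹ q →
    ∃[ r ] (IsCond U r × q ≤ᴹ r × ∃[ r' ] (IsCond U r' × Ċ k r' × r' ≤ᴹ r))

Forces∉ : (Subset → Set) → Name → Pair → ℕ → Set
Forces∉ U Ċ p k =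
  ∀ q → IsCond U q → p ≤ᴹ q → ¬ (∃[ r' ] (IsCond U r' × Ċ k r' × r' ≤ᴹ q))

-- p ⊩ Ċ ∩ M = Ď   (M = {0,…,M-1}, D finite)
ForcesInit : (Subset → Set) → Name → Pair → ℕ → FinSet → Set
ForcesInit U Ċ p M D =
  ∀ k → k < M → (k ∈ D → Forces∈ U Ċ p k) × (¬ (k ∈ D) → Forces∉ U Ċ p k)

NameForInfinite : (Subset → Set) → Name → Set
NameForInfinite U Ċ =
  ∀ p → IsCond U p → ∀ n →
    ∃[ q ] (IsCond U q × p ≤ᴹ q × ∃[ k ] (n < k × Forces∈ U Ċ q k))

{-# OPTIONS --safe #-}

-- For each m, the finitely many colourings n ↦ [k ∈ C (t ∪ {n})] with t ⊆ m + 1 and k ≤ m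
-- have a common homogeneous set y m ∈ U.  A play won by Death against the Maiden strategy
-- that answers each move m by shrinking to y m gives x₂ ∈ U with n ∈ y m whenever m < n
-- lie in x₂.  The condition ⟨s ∪ t, x₁ ∖ (max t + 1)⟩ only depends on the set t, hence so
-- does C t below max t + 1; so for max t ≤ m the list t can be replaced by the increasing
-- enumeration of t ∩ (m + 1), one of the finitely many t above, and n ∈ y m makes
-- k ∈ C (t ∪ {n}) independent of n.
module Submission where

open import Defs
open import Level using (0ℓ)
open import Axiom.ExcludedMiddle using (ExcludedMiddle)
open import Axiom.DoubleNegationElimination using (em⇒dne)
open import Data.Bool using (true; false)
open import Data.Bool.Properties using (∧-conicalˡ; ∧-conicalʳ; not-injective; not-¬; T-≡)
open import Data.Nat using (ℕ; zero; suc; _<_; _≤_; _<ᵇ_; z≤n; s≤s)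
open import Data.Nat.Properties
  using (_≟_; ≤-refl; ≤-trans; ≤-<-trans; <-≤-trans; <⇒≤; <⇒≱; ≰⇒>; m≤n⇒m<n∨m≡n; m≤m⊔n; m≤n⊔m; ⊔-lub; <ᵇ⇒<; <⇒<ᵇ)
open import Data.List using (List; []; _∷_; _++_; [_]; foldr; map; filter; upTo; cartesianProduct)
open import Data.List.Membership.Propositional using (_∈_)
open import Data.List.Membership.Propositional.Properties
  using (∈-++⁺ˡ; ∈-++⁺ʳ; ∈-++⁻; ∈-map⁺; ∈-upTo⁺; ∈-cartesianProduct⁺; ∈-filter⁺; ∈-filter⁻)
open import Data.List.Membership.DecPropositional _≟_ using (_∈?_)
open import Data.List.Relation.Binary.Subset.Propositional using (_⊆_)
import Data.List.Relation.Binary.Subset.Propositional.Properties as ⊆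
open import Data.List.Relation.Unary.All as All using (All; []; _∷_)
import Data.List.Relation.Unary.All.Properties as Allₚ
open import Data.List.Relation.Unary.Any using (here; there)
open import Data.Product using (_×_; _,_; ∃-syntax; proj₁; proj₂)
open import Data.Sum using (inj₁; inj₂)
open import Data.Empty using (⊥-elim)
open import Function using (_∘_)
open import Function.Bundles using (Equivalence; _⇔_; mk⇔)
open import Relation.Nullary using (¬_; Dec; yes; no; does; contradiction)
open import Relation.Nullary.Decidable using (dec-true)
open import Relation.Unary using (Decidable)
open import Relation.Binary.PropositionalEquality using (_≡_; refl; sym; trans)

∩ˢ-⊆ˡ : ∀ x y → (x ∩ˢ y) ⊆ˢ x
∩ˢ-⊆ˡ x y k = ∧-conicalˡ (x k) (y k)

∩ˢ-⊆ʳ : ∀ x y → (x ∩ˢ y) ⊆ˢ y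
∩ˢ-⊆ʳ x y k = ∧-conicalʳ (x k) (y k)

∈-∩ˢ⁺ : ∀ x y {k} → k ∈ˢ x → k ∈ˢ y → k ∈ˢ (x ∩ˢ y)
∈-∩ˢ⁺ x y k∈x k∈y rewrite k∈x | k∈y = refl

∩ˢ-monoʳ : ∀ x {y y'} → y ⊆ˢ y' → (x ∩ˢ y) ⊆ˢ (x ∩ˢ y')
∩ˢ-monoʳ x {y} {y'} y⊆y' k k∈ = ∈-∩ˢ⁺ x y' (∩ˢ-⊆ˡ x y k k∈) (y⊆y' k (∩ˢ-⊆ʳ x y k k∈))

⊤ˢ : Subset
⊤ˢ _ = true

⋂ˢ : List Subset → Subset
⋂ˢ = foldr _∩ˢ_ ⊤ˢ

∈-⋂ˢ⁻ : ∀ {xs x k} → k ∈ˢ ⋂ˢ xs → x ∈ xs → k ∈ˢ x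
∈-⋂ˢ⁻ {x ∷ xs} k∈⋂ (here refl) = ∩ˢ-⊆ˡ x (⋂ˢ xs) _ k∈⋂
∈-⋂ˢ⁻ {x ∷ xs} k∈⋂ (there x'∈) = ∈-⋂ˢ⁻ (∩ˢ-⊆ʳ x (⋂ˢ xs) _ k∈⋂) x'∈

∈-⋂ˢ⁺ : ∀ xs {k} → (∀ {x} → x ∈ xs → k ∈ˢ x) → k ∈ˢ ⋂ˢ xs
∈-⋂ˢ⁺ [] _ = refl
∈-⋂ˢ⁺ (x ∷ xs) k∈all = ∈-∩ˢ⁺ x (⋂ˢ xs) (k∈all (here refl)) (∈-⋂ˢ⁺ xs λ x'∈ → k∈all (there x'∈))

⋂ˢ-antitone : ∀ {xs ys} → xs ⊆ ys → ⋂ˢ ys ⊆ˢ ⋂ˢ xs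
⋂ˢ-antitone {xs} xs⊆ys k k∈⋂ = ∈-⋂ˢ⁺ xs λ x∈xs → ∈-⋂ˢ⁻ k∈⋂ (xs⊆ys x∈xs)

∈-∖↑⇒< : ∀ x M {k} → k ∈ˢ (x ∖↑ M) → M < k
∈-∖↑⇒< x M {k} k∈ = <ᵇ⇒< M k (Equivalence.from T-≡ (∧-conicalʳ (x k) _ k∈))

∈-∖↑⁺ : ∀ x M {k} → k ∈ˢ x → M < k → k ∈ˢ (x ∖↑ M)
∈-∖↑⁺ x M k∈x M<k rewrite k∈x = Equivalence.to T-≡ (<⇒<ᵇ M<k)

∖↑-antitone : ∀ x {M M'} → M ≤ M' → (x ∖↑ M') ⊆ˢ (x ∖↑ M)
∖↑-antitone x {M} {M'} M≤M' k k∈ =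
  ∈-∖↑⁺ x M (∩ˢ-⊆ˡ x (M' <ᵇ_) k k∈) (≤-<-trans M≤M' (∈-∖↑⇒< x M' k∈))

≤-maxᶠ : ∀ t {k} → k ∈ t → k ≤ maxᶠ t
≤-maxᶠ (a ∷ t) (here refl) = m≤m⊔n a (maxᶠ t)
≤-maxᶠ (a ∷ t) (there k∈t) = ≤-trans (≤-maxᶠ t k∈t) (m≤n⊔m a (maxᶠ t))

maxᶠ-mono : ∀ {t t'} → t ⊆ᶠ t' → maxᶠ t ≤ maxᶠ t'
maxᶠ-mono {[]} _ = z≤n
maxᶠ-mono {a ∷ t} {t'} t⊆t' = ⊔-lub (≤-maxᶠ t' (t⊆t' (here refl))) (maxᶠ-mono λ k∈t → t⊆t' (there k∈t))

sublists : {A : Set} → List A → List (List A)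
sublists [] = [ [] ]
sublists (a ∷ as) = map (a ∷_) (sublists as) ++ sublists as

filter∈sublists : {A : Set} {P : A → Set} (P? : Decidable P) (xs : List A) → filter P? xs ∈ sublists xs
filter∈sublists P? [] = here refl
filter∈sublists P? (a ∷ as) with does (P? a)
... | true = ∈-++⁺ˡ (∈-map⁺ (a ∷_) (filter∈sublists P? as))
... | false = ∈-++⁺ʳ (map (a ∷_) (sublists as)) (filter∈sublists P? as)

normalise : ℕ → FinSet → FinSet
normalise m t = filter (_∈? t) (upTo (suc m))

normalise-⊆ : ∀ m t → normalise m t ⊆ᶠ t
normalise-⊆ m t k∈ = proj₂ (∈-filter⁻ (_∈? t) k∈)

⊆-normalise : ∀ {m} t → maxᶠ t ≤ m → t ⊆ᶠ normalise m t
⊆-normalise t max≤m k∈t = ∈-filter⁺ (_∈? t) (∈-upTo⁺ (s≤s (≤-trans (≤-maxᶠ t k∈t) max≤m))) k∈t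

increasing-mono-≤ : ∀ {d : ℕ → ℕ} → (∀ i → d i < d (suc i)) → ∀ {i j} → i ≤ j → d i ≤ d j
increasing-mono-≤ d↑ {j = zero} z≤n = ≤-refl
increasing-mono-≤ d↑ {i} {suc j} i≤1+j with m≤n⇒m<n∨m≡n i≤1+j
... | inj₁ (s≤s i≤j) = ≤-trans (increasing-mono-≤ d↑ i≤j) (<⇒≤ (d↑ j))
... | inj₂ refl = ≤-refl

increasing-reflects-< : ∀ {d : ℕ → ℕ} → (∀ i → d i < d (suc i)) → ∀ {i j} → d i < d j → i < j
increasing-reflects-< d↑ dᵢ<dⱼ = ≰⇒> λ j≤i → <⇒≱ dᵢ<dⱼ (increasing-mono-≤ d↑ j≤i)

does-≡⇒ : {A B : Set} (a? : Dec A) (b? : Dec B) → does a? ≡ does b? → A → B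
does-≡⇒ a? (yes b) _ _ = b
does-≡⇒ a? (no _) eq a = contradiction (trans (sym (dec-true a? a)) eq) λ ()

Homogeneous : Subset → Subset → Set
Homogeneous f h = ∀ {n n'} → n ∈ˢ h → n' ∈ˢ h → f n ≡ f n'

homogeneous-⊆ : ∀ {f h h'} → h' ⊆ˢ h → Homogeneous f h → Homogeneous f h'
homogeneous-⊆ h'⊆h hom n∈ n'∈ = hom (h'⊆h _ n∈) (h'⊆h _ n'∈)

module UltrafilterProperties {U : Subset → Set} (ultrafilter : IsNPUltrafilter U) where
  open IsNPUltrafilter ultrafilter

  ⊤ˢ∈U : U ⊤ˢ
  ⊤ˢ∈U with ultra ∅ˢ
  ... | inj₁ ∅∈U = ⊥-elim (proper ∅∈U)
  ... | inj₂ ∁∅∈U = ∁∅∈U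

  ⋂ˢ∈U : ∀ {xs} → All U xs → U (⋂ˢ xs)
  ⋂ˢ∈U [] = ⊤ˢ∈U
  ⋂ˢ∈U (x∈U ∷ xs∈U) = inter x∈U (⋂ˢ∈U xs∈U)

  cofinite∈U : ∀ M → U (M <ᵇ_)
  cofinite∈U M with ultra (M <ᵇ_)
  ... | inj₁ cofinite∈U = cofinite∈U
  ... | inj₂ finite∈U with nonPrincipal finite∈U M
  ...   | k , M<k , k∉ = ⊥-elim (not-¬ (sym (Equivalence.to T-≡ (<⇒<ᵇ M<k))) (sym k∉))

  ∖↑∈U : ∀ {x} → U x → ∀ M → U (x ∖↑ M)
  ∖↑∈U x∈U M = inter x∈U (cofinite∈U M)

  ∃-homogeneous : ∀ f → ∃[ h ] (U h × Homogeneous f h)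
  ∃-homogeneous f with ultra f
  ... | inj₁ f∈U = f , f∈U , λ n∈f n'∈f → trans n∈f (sym n'∈f)
  ... | inj₂ ∁f∈U = ∁ f , ∁f∈U , λ n∈∁f n'∈∁f → not-injective (trans n∈∁f (sym n'∈∁f))

  ∃-homogeneousAll : ∀ fs → ∃[ h ] (U h × All (λ f → Homogeneous f h) fs)
  ∃-homogeneousAll [] = ⊤ˢ , ⊤ˢ∈U , []
  ∃-homogeneousAll (f ∷ fs) with ∃-homogeneous f | ∃-homogeneousAll fs
  ... | h , h∈U , hom | h' , h'∈U , homs =
    h ∩ˢ h' , inter h∈U h'∈U ,
    homogeneous-⊆ (∩ˢ-⊆ˡ h h') hom ∷ All.map (homogeneous-⊆ (∩ˢ-⊆ʳ h h')) homs

Diagonal : (ℕ → Subset) → Subset → Set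
Diagonal y x = ∀ {m n} → m ∈ˢ x → n ∈ˢ x → m < n → n ∈ˢ y m

module _ {U : Subset → Set} (ramsey : IsRamsey U) where
  open IsNPUltrafilter (proj₁ ramsey)
  open UltrafilterProperties (proj₁ ramsey)

  diagonalIntersection : ExcludedMiddle 0ℓ → ∀ {x₁} → U x₁ → (y : ℕ → Subset) → (∀ m → U (y m)) →
    ∃[ x ] (U x × x ⊆ˢ x₁ × Diagonal y x)
  diagonalIntersection em {x₁} x₁∈U y y∈U =
    fromPlay (em⇒dne em λ noWinningPlay →
      proj₂ ramsey σ (σ∈U , σ-shrinks) λ d play wins → noWinningPlay (d , play , wins))
    where
      σ : Strategy
      σ h = x₁ ∩ˢ ⋂ˢ (map y h)

      σ∈U : ∀ h → U (σ h)
      σ∈U h = inter x₁∈U (⋂ˢ∈U (Allₚ.map⁺ (All.universal y∈U h)))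

      σ-shrinks : ∀ h n → σ (h ++ [ n ]) ⊆ˢ σ h
      σ-shrinks h n = ∩ˢ-monoʳ x₁ (⋂ˢ-antitone (⊆.map⁺ y (⊆.xs⊆xs++ys h [ n ])))

      fromPlay : ∃[ d ] (ConsistentPlay σ d × DeathWins U d) → ∃[ x ] (U x × x ⊆ˢ x₁ × Diagonal y x)
      fromPlay (d , (d∈σ , d↑) , x , x∈U , range) = x , x∈U , x⊆x₁ , diagonal
        where
          x⊆x₁ : x ⊆ˢ x₁
          x⊆x₁ k k∈x with proj₁ (range k) k∈x
          ... | i , refl = ∩ˢ-⊆ˡ x₁ (⋂ˢ (map y (prefix d i))) _ (d∈σ i)

          diagonal : Diagonal y x
          diagonal m∈x n∈x m<n with proj₁ (range _) m∈x | proj₁ (range _) n∈x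
          ... | i , refl | j , refl =
            ∈-⋂ˢ⁻ (∩ˢ-⊆ʳ x₁ (⋂ˢ (map y (prefix d j))) _ (d∈σ j))
              (∈-map⁺ y (∈-map⁺ d (∈-upTo⁺ (increasing-reflects-< d↑ m<n))))

module _ {U : Subset → Set} {Ċ : Name} where

  Forces∈⇒¬Forces∉ : ∀ {p q k} → IsCond U q → p ≤ᴹ q → Forces∈ U Ċ p k → ¬ Forces∉ U Ċ q k
  Forces∈⇒¬Forces∉ q-cond p≤q p⊩k∈Ċ q⊩k∉Ċ with p⊩k∈Ċ _ q-cond p≤q
  ... | r , r-cond , q≤r , r' , r'-cond , r'⊩k∈Ċ , r'≤r = q⊩k∉Ċ r r-cond q≤r (r' , r'-cond , r'⊩k∈Ċ , r'≤r)

  ForcesInit-≤ᴹ-∈ : ∀ {p q M M' D D' k} → IsCond U q → p ≤ᴹ q →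
    ForcesInit U Ċ p M D → ForcesInit U Ċ q M' D' → k < M → k < M' → k ∈ D → k ∈ D'
  ForcesInit-≤ᴹ-∈ {D' = D'} {k} q-cond p≤q p⊩D q⊩D' k<M k<M' k∈D with k ∈? D'
  ... | yes k∈D' = k∈D'
  ... | no k∉D' = ⊥-elim (Forces∈⇒¬Forces∉ q-cond p≤q (proj₁ (p⊩D k k<M) k∈D) (proj₂ (q⊩D' k k<M') k∉D'))

module Homogenisation {U : Subset → Set} (ultrafilter : IsNPUltrafilter U) {Ċ : Name} {s : FinSet} {x₁ : Subset}
  (cond₁ : IsCond U (s , x₁)) (C : FinSet → FinSet)
  (C-forced : ∀ t → t ⊆ᶠˢ x₁ → ForcesInit U Ċ (s ++ t , x₁ ∖↑ maxᶠ t) (suc (maxᶠ t)) (C t)) where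
  open UltrafilterProperties ultrafilter

  extension : FinSet → Pair
  extension t = s ++ t , x₁ ∖↑ maxᶠ t

  extension-IsCond : ∀ t → IsCond U (extension t)
  extension-IsCond t = ∖↑∈U (proj₁ cond₁) (maxᶠ t) , below
    where
      below : ∀ {i} → i ∈ s ++ t → ∀ j → j ∈ˢ (x₁ ∖↑ maxᶠ t) → i < j
      below {i} i∈ j j∈ with ∈-++⁻ s i∈
      ... | inj₁ i∈s = proj₂ cond₁ i∈s j (∩ˢ-⊆ˡ x₁ (maxᶠ t <ᵇ_) j j∈)
      ... | inj₂ i∈t = ≤-<-trans (≤-maxᶠ t i∈t) (∈-∖↑⇒< x₁ (maxᶠ t) j∈)

  extension-≤ᴹ : ∀ {t t'} → t ⊆ᶠ t' → t' ⊆ᶠ t → extension t ≤ᴹ extension t'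
  extension-≤ᴹ t⊆t' t'⊆t =
    ⊆.++⁺ʳ s t⊆t' , ∖↑-antitone x₁ (maxᶠ-mono t⊆t') , λ k∈ k∉ → ⊥-elim (k∉ (⊆.++⁺ʳ s t'⊆t k∈))

  C-resp-sameElements : ∀ {t t' k} → t ⊆ᶠˢ x₁ → t' ⊆ᶠˢ x₁ → t ⊆ᶠ t' → t' ⊆ᶠ t →
    k ≤ maxᶠ t → k ∈ C t → k ∈ C t'
  C-resp-sameElements {t} {t'} t⊆x₁ t'⊆x₁ t⊆t' t'⊆t k≤max =
    ForcesInit-≤ᴹ-∈ (extension-IsCond t') (extension-≤ᴹ t⊆t' t'⊆t) (C-forced t t⊆x₁) (C-forced t' t'⊆x₁)
      (s≤s k≤max) (s≤s (≤-trans k≤max (maxᶠ-mono t⊆t')))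

  colour : FinSet × ℕ → Subset
  colour (t , k) n = does (k ∈? C (t ++ [ n ]))

  colour-≡⇒∈ : ∀ {t k n n'} → colour (t , k) n ≡ colour (t , k) n' → k ∈ C (t ++ [ n ]) → k ∈ C (t ++ [ n' ])
  colour-≡⇒∈ {t} {k} {n} {n'} = does-≡⇒ (k ∈? C (t ++ [ n ])) (k ∈? C (t ++ [ n' ]))

  colours : ℕ → List Subset
  colours m = map colour (cartesianProduct (sublists (upTo (suc m))) (upTo (suc m)))

  homogeniser : ℕ → Subset
  homogeniser m = proj₁ (∃-homogeneousAll (colours m))

  homogeniser∈U : ∀ m → U (homogeniser m)
  homogeniser∈U m = proj₁ (proj₂ (∃-homogeneousAll (colours m)))

  homogeniser-homogeneous : ∀ {m t k} → k ≤ m → Homogeneous (colour (normalise m t , k)) (homogeniser m)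
  homogeniser-homogeneous {m} {t} k≤m =
    All.lookup (proj₂ (proj₂ (∃-homogeneousAll (colours m))))
      (∈-map⁺ colour (∈-cartesianProduct⁺ (filter∈sublists (_∈? t) (upTo (suc m))) (∈-upTo⁺ (s≤s k≤m))))

  C-normalise : ∀ {t m n k} → t ⊆ᶠˢ x₁ → n ∈ˢ x₁ → maxᶠ t ≤ m → k ≤ m → m < n →
    k ∈ C (t ++ [ n ]) ⇔ k ∈ C (normalise m t ++ [ n ])
  C-normalise {t} {m} {n} {k} t⊆x₁ n∈x₁ t≤m k≤m m<n =
    mk⇔ (C-resp-sameElements (with-n t⊆x₁) (with-n T⊆x₁) (⊆.++⁺ˡ [ n ] t⊆T) (⊆.++⁺ˡ [ n ] T⊆t) (k≤max t))
        (C-resp-sameElements (with-n T⊆x₁) (with-n t⊆x₁) (⊆.++⁺ˡ [ n ] T⊆t) (⊆.++⁺ˡ [ n ] t⊆T) (k≤max T))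
    where
      T : FinSet
      T = normalise m t

      t⊆T : t ⊆ᶠ T
      t⊆T = ⊆-normalise t t≤m

      T⊆t : T ⊆ᶠ t
      T⊆t = normalise-⊆ m t

      T⊆x₁ : T ⊆ᶠˢ x₁
      T⊆x₁ k∈T = t⊆x₁ (T⊆t k∈T)

      with-n : ∀ {u} → u ⊆ᶠˢ x₁ → (u ++ [ n ]) ⊆ᶠˢ x₁
      with-n {u} u⊆x₁ k∈ with ∈-++⁻ u k∈
      ... | inj₁ k∈u = u⊆x₁ k∈u
      ... | inj₂ (here refl) = n∈x₁

      k≤max : ∀ u → k ≤ maxᶠ (u ++ [ n ])
      k≤max u = ≤-trans k≤m (<⇒≤ (<-≤-trans m<n (≤-maxᶠ (u ++ [ n ]) (∈-++⁺ʳ u (here refl)))))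

  C-stable : ∀ {x} → x ⊆ˢ x₁ → Diagonal homogeniser x →
    ∀ {t m n n' k} → t ⊆ᶠˢ x → m ∈ˢ x → maxᶠ t ≤ m → n ∈ˢ x → n' ∈ˢ x → m < n → m < n' → k ≤ m →
    k ∈ C (t ++ [ n ]) → k ∈ C (t ++ [ n' ])
  C-stable {x} x⊆x₁ diagonal {t} t⊆x m∈x t≤m n∈x n'∈x m<n m<n' k≤m =
    Equivalence.from (C-normalise t⊆x₁ (x⊆x₁ _ n'∈x) t≤m k≤m m<n')
    ∘ colour-≡⇒∈ (homogeniser-homogeneous {t = t} k≤m (diagonal m∈x n∈x m<n) (diagonal m∈x n'∈x m<n'))
    ∘ Equivalence.to (C-normalise t⊆x₁ (x⊆x₁ _ n∈x) t≤m k≤m m<n)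
    where
      t⊆x₁ : t ⊆ᶠˢ x₁
      t⊆x₁ k∈t = x⊆x₁ _ (t⊆x k∈t)

mainTheorem3 : ExcludedMiddle 0ℓ →
    (U : Subset → Set) → IsRamsey U →
    (Ċ : Name) → NameForInfinite U Ċ →
    (s : FinSet) (x₁ : Subset) → IsCond U (s , x₁) →
    (C : FinSet → FinSet) →
    (∀ t → t ⊆ᶠˢ x₁ →
      ForcesInit U Ċ (s ++ t , x₁ ∖↑ maxᶠ t) (suc (maxᶠ t)) (C t)) →
    ∃[ x₂ ] (U x₂ × x₂ ⊆ˢ x₁ ×
      (∀ t → t ⊆ᶠˢ x₂ → ∀ m → m ∈ˢ x₂ → maxᶠ t ≤ m →
        ∀ n n' → n ∈ˢ x₂ → n' ∈ˢ x₂ → m < n → m < n' →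
        ∀ k → k ≤ m →
          ((k ∈ C (t ++ [ n ]) → k ∈ C (t ++ [ n' ])) ×
           (k ∈ C (t ++ [ n' ]) → k ∈ C (t ++ [ n ])))))
mainTheorem3 em U ramsey Ċ _ s x₁ cond₁ C C-forced =
  let open Homogenisation (proj₁ ramsey) cond₁ C C-forced
      x₂ , x₂∈U , x₂⊆x₁ , diagonal = diagonalIntersection ramsey em (proj₁ cond₁) homogeniser homogeniser∈U
  in x₂ , x₂∈U , x₂⊆x₁ , λ t t⊆x₂ m m∈x₂ t≤m n n' n∈x₂ n'∈x₂ m<n m<n' k k≤m →
       C-stable x₂⊆x₁ diagonal t⊆x₂ m∈x₂ t≤m n∈x₂ n'∈x₂ m<n m<n' k≤m ,
       C-stable x₂⊆x₁ diagonal t⊆x₂ m∈x₂ t≤m n'∈x₂ n∈x₂ m<n' m<n k≤m
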